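{- Let $m\le n$ be positive integers and $j\in[n]$. If $j>n-m+1$, the number of $\alpha=(a_1,\dots,a_m)\in\mathrm{PF}_{m,n}$ with $a_1=j$ is $$\sum_{i=j}^{n}\binom{m-1}{n-i}(n-m+1)\,i^{\,i+m-n-2}(n-i+1)^{n-i-1},$$ and if $j\le n-m+1$, the number of $\alpha\in\mathrm{PF}_{m,n}$ with $a_1=j$ is $$m^{m-2}+\sum_{i=n-m+2}^{n}\binom{m-1}{n-i}(n-m+1)\,i^{\,i+m-n-2}(n-i+1)^{n-i-1}.$$
   Context: $[n]=\{1,\dots,n\}$. For integers $0\le m\le n$, $\mathrm{PF}_{m,n}$ is the set of $(m,n)$-parking functions: sequences $(a_1,\dots,a_m)\in[n]^m$ whose nondecreasing rearrangement $a'_1\le\dots\le a'_m$ satisfies $a'_i\le n-m+i$ for all $i$ (equivalently, $m$ cars arriving in order on a one-way street with $n$ spots, each parking in its preferred spot $a_i$ or else the first unoccupied spot after it, all park). -}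

module Defs where

open import Data.Nat using (ℕ; zero; suc; _+_; _*_; _∸_; _^_; _≤ᵇ_)
open import Data.Nat.Properties using (≤-decTotalOrder)
open import Data.Nat.Combinatorics using (_C_)
open import Data.Bool using (Bool; true; false; _∧_; T)
open import Data.List using (List; []; _∷_; map; upTo; head)
open import Data.Nat.ListAction using (sum)
open import Data.List.Base using (all)
open import Data.Maybe using (just)
open import Data.Vec using (Vec; toList)
open import Data.Product using (Σ; _×_)
open import Relation.Binary.PropositionalEquality using (_≡_)
import Data.List.Sort

open Data.List.Sort ≤-decTotalOrder using (sort)

inRange : ℕ → ℕ → Bool
inRange n a = (1 ≤ᵇ a) ∧ (a ≤ᵇ n)

boundsOK : ℕ → List ℕ → Bool
boundsOK b []       = true
boundsOK b (x ∷ xs) = (x ≤ᵇ b) ∧ boundsOK (suc b) xs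

-- (m,n)-parking function: entries in [n], and the nondecreasing
-- rearrangement a'_1 ≤ … ≤ a'_m satisfies a'_i ≤ n - m + i.
isPF : ℕ → ℕ → List ℕ → Bool
isPF m n α = all (inRange n) α ∧ boundsOK (suc (n ∸ m)) (sort α)

PFFirst : ℕ → ℕ → ℕ → Set
PFFirst m n j = Σ (Vec ℕ m) (λ α → T (isPF m n (toList α)) × head (toList α) ≡ just j)

-- Σ_{i=a}^{b} f i  (empty if b < a)
sumFromTo : ℕ → ℕ → (ℕ → ℕ) → ℕ
sumFromTo a b f = sum (map (λ k → f (a + k)) (upTo (suc b ∸ a)))

-- binom(m-1, n-i) (n-m+1) i^(i+m-n-2) (n-i+1)^(n-i-1)
-- (exponents via truncated subtraction)
term : ℕ → ℕ → ℕ → ℕ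
term m n i = ((m ∸ 1) C (n ∸ i)) * (suc (n ∸ m)) * (i ^ ((i + m) ∸ (n + 2))) * ((suc (n ∸ i)) ^ ((n ∸ i) ∸ 1))

module Submission where

-- A word L with entries in [1, n] parks on n spots iff, for every k, at most n − k of its entries
-- exceed k. Hence j ∷ L parks iff L parks and no k < j is tight for L (has exactly n − k entries of
-- L above it). As n itself is tight, classifying L by its least tight point i ∈ [j, n] turns the
-- count into a sum over i. A parking word with least tight point i is a shuffle of a word with
-- e = n − i entries in i + 1, …, n parking on those e spots and a word parking on i − 1 spots, so
-- there are (m − 1 choose e) · pf(e, e) · pf(m − 1 − e, i − 1) of them, where the number of
-- (a, b)-parking functions is pf(a, b) = (b + 1 − a)(b + 1)^(a − 1). This closed form follows from
-- pf(a, b + 1) = Σ_r (a choose r) pf(r, b), obtained by deleting the entries equal to 1, together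
-- with the binomial theorem and its derivative. The summands with i < n − m + 1 vanish and
-- i = n − m + 1 contributes m^(m − 2).

open import Defs
open import Data.Nat using (ℕ; _+_; _∸_; _^_; _≤_; _<_)
open import Data.Fin using (Fin)
open import Data.Product using (_×_)
open import Function.Bundles using (_↔_)

open import Data.Bool using (T)
open import Data.Bool.Properties using (T-∧; T-irrelevant)
import Data.Fin as Fin
open import Data.Fin.Properties using (+↔⊎)
open import Data.List using (List; []; _∷_; map; _++_; length; filter; applyUpTo)
open import Data.List.Properties
  using (map-++; ++-identityʳ; filter-accept; filter-reject; filter-++; filter-all; filter-none)
open import Data.List.Relation.Binary.Permutation.Propositional using (_↭_; ↭-sym)
open import Data.List.Relation.Binary.Permutation.Propositional.Properties using (map⁺; ↭-length)
open import Data.List.Relation.Unary.All using (All; []; _∷_)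
import Data.List.Relation.Unary.All as All
open import Data.List.Relation.Unary.All.Properties using (all⁺; all⁻; all-filter)
import Data.List.Relation.Unary.Linked as Linked
open import Data.List.Relation.Unary.Linked.Properties using (Linked⇒All)
open import Data.Nat.Base using (zero; suc; _*_; z≤n; s≤s; _≤ᵇ_)
open import Data.Nat.Combinatorics using (_C_; k>n⇒nCk≡0; nCk+nC[k+1]≡[n+1]C[k+1]; nCn≡1)
open import Data.Nat.ListAction using (sum)
open import Data.Nat.ListAction.Properties using (sum-++; sum-↭)
open import Data.Nat.Properties
open import Data.List.Relation.Unary.Sorted.TotalOrder ≤-totalOrder using (Sorted)
open import Data.List.Sort ≤-decTotalOrder using (sort; sort-↭; sort-↗)
open import Algebra.Properties.CommutativeSemigroup +-commutativeSemigroup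
  using (interchange; x∙yz≈y∙xz; x∙yz≈xz∙y)
open import Data.Nat.Tactic.RingSolver using (solve-∀)
open import Data.Product using (Σ; _,_; proj₁; proj₂)
open import Data.Product.Function.NonDependent.Propositional using (_×-⇔_)
open import Data.Sum using (_⊎_; inj₁; inj₂)
open import Data.Sum.Function.Propositional using (_⊎-↔_)
open import Data.Unit using (⊤; tt)
open import Data.Vec using (Vec; toList) renaming ([] to []ᵥ; _∷_ to _∷ᵥ_)
open import Function.Base using (_∘_; id)
open import Function.Bundles using (mk↔ₛ′; _⇔_; mk⇔; Equivalence)
import Function.Properties.Equivalence as ⇔
open import Function.Properties.Inverse using (↔-refl; ↔-trans)
open import Function.Related.Propositional as Related using (bijection)
open import Relation.Binary.PropositionalEquality
open import Relation.Nullary using (¬_; Dec; yes; no; ¬?; contradiction; Irrelevant)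
open import Relation.Nullary.Decidable using (_×-dec_; map′; T?)
open import Relation.Unary using (Decidable; ∁)
open import Relation.Unary.Properties using (∁?)

-- Finite sums

∑< : ℕ → (ℕ → ℕ) → ℕ
∑< zero    f = 0
∑< (suc k) f = f 0 + ∑< k (f ∘ suc)

syntax ∑< k (λ d → e) = ∑[ d < k ] e

∑<-cong : ∀ k {f g : ℕ → ℕ} → (∀ d → d < k → f d ≡ g d) → ∑< k f ≡ ∑< k g
∑<-cong zero    f≡g = refl
∑<-cong (suc k) f≡g = cong₂ _+_ (f≡g 0 (s≤s z≤n)) (∑<-cong k (λ d d<k → f≡g (suc d) (s≤s d<k)))

∑<-+ : ∀ k (f g : ℕ → ℕ) → ∑[ d < k ] (f d + g d) ≡ ∑< k f + ∑< k g
∑<-+ zero    f g = refl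
∑<-+ (suc k) f g = trans (cong (f 0 + g 0 +_) (∑<-+ k (f ∘ suc) (g ∘ suc))) (interchange (f 0) (g 0) _ _)

∑<-*ˡ : ∀ k c (f : ℕ → ℕ) → ∑[ d < k ] (c * f d) ≡ c * ∑< k f
∑<-*ˡ zero    c f = sym (*-zeroʳ c)
∑<-*ˡ (suc k) c f = trans (cong (c * f 0 +_) (∑<-*ˡ k c (f ∘ suc))) (sym (*-distribˡ-+ c (f 0) _))

∑<-zero : ∀ k {f : ℕ → ℕ} → (∀ d → d < k → f d ≡ 0) → ∑< k f ≡ 0
∑<-zero zero    f≡0 = refl
∑<-zero (suc k) f≡0 = cong₂ _+_ (f≡0 0 (s≤s z≤n)) (∑<-zero k (λ d d<k → f≡0 (suc d) (s≤s d<k)))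

∑<-last : ∀ k (f : ℕ → ℕ) → ∑< (suc k) f ≡ ∑< k f + f k
∑<-last zero    f = +-comm (f 0) 0
∑<-last (suc k) f = trans (cong (f 0 +_) (∑<-last k (f ∘ suc))) (sym (+-assoc (f 0) _ _))

∑<-single : ∀ k (f : ℕ → ℕ) r → r < k → (∀ d → d < k → d ≢ r → f d ≡ 0) → ∑< k f ≡ f r
∑<-single (suc k) f zero    _         f≡0 =
  trans (cong (f 0 +_) (∑<-zero k (λ d d<k → f≡0 (suc d) (s≤s d<k) λ ()))) (+-identityʳ (f 0))
∑<-single (suc k) f (suc r) (s≤s r<k) f≡0 =
  cong₂ _+_ (f≡0 0 (s≤s z≤n) λ ()) (∑<-single k (f ∘ suc) r r<k
    (λ d d<k d≢r → f≡0 (suc d) (s≤s d<k) (d≢r ∘ suc-injective)))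

∑<-pascal : ∀ a (f : ℕ → ℕ) →
  ∑[ r < suc (suc a) ] ((suc a C r) * f r) ≡ ∑[ r < suc a ] ((a C r) * (f r + f (suc r)))
∑<-pascal a f = begin
    1 * f 0 + ∑[ d < suc a ] ((suc a C suc d) * f (suc d))
  ≡⟨ cong (1 * f 0 +_) (∑<-cong (suc a) λ d _ → cong (_* f (suc d)) (sym (nCk+nC[k+1]≡[n+1]C[k+1] a d))) ⟩
    1 * f 0 + ∑[ d < suc a ] ((a C d + a C suc d) * f (suc d))
  ≡⟨ cong (1 * f 0 +_) (trans (∑<-cong (suc a) λ d _ → *-distribʳ-+ (f (suc d)) (a C d) (a C suc d))
                              (∑<-+ (suc a) (λ d → (a C d) * f (suc d)) (λ d → (a C suc d) * f (suc d)))) ⟩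
    1 * f 0 + (U + ∑[ d < suc a ] ((a C suc d) * f (suc d)))
  ≡⟨ cong (λ z → 1 * f 0 + (U + z)) top-vanishes ⟩
    1 * f 0 + (U + R)
  ≡⟨ x∙yz≈xz∙y (1 * f 0) U R ⟩
    (1 * f 0 + R) + U
  ≡⟨ trans (∑<-cong (suc a) λ r _ → *-distribˡ-+ (a C r) (f r) (f (suc r)))
           (∑<-+ (suc a) (λ r → (a C r) * f r) (λ r → (a C r) * f (suc r))) ⟨
    ∑[ r < suc a ] ((a C r) * (f r + f (suc r)))
  ∎
  where
  open ≡-Reasoning
  R = ∑[ d < a ] ((a C suc d) * f (suc d))
  U = ∑[ d < suc a ] ((a C d) * f (suc d))
  top-vanishes : ∑[ d < suc a ] ((a C suc d) * f (suc d)) ≡ R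
  top-vanishes = trans (∑<-last a _)
    (trans (cong (λ c → R + c * f (suc a)) (k>n⇒nCk≡0 (n<1+n a))) (+-identityʳ R))

∑<-binomial : ∀ x a → ∑[ r < suc a ] ((a C r) * x ^ r) ≡ suc x ^ a
∑<-binomial x zero    = refl
∑<-binomial x (suc a) = begin
    ∑[ r < suc (suc a) ] ((suc a C r) * x ^ r)
  ≡⟨ ∑<-pascal a (x ^_) ⟩
    ∑[ r < suc a ] ((a C r) * (x ^ r + x ^ suc r))
  ≡⟨ ∑<-cong (suc a) (λ r _ → factor x (a C r) (x ^ r)) ⟩
    ∑[ r < suc a ] (suc x * ((a C r) * x ^ r))
  ≡⟨ ∑<-*ˡ (suc a) (suc x) (λ r → (a C r) * x ^ r) ⟩
    suc x * ∑[ r < suc a ] ((a C r) * x ^ r)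
  ≡⟨ cong (suc x *_) (∑<-binomial x a) ⟩
    suc x ^ suc a
  ∎
  where
  open ≡-Reasoning
  factor : ∀ x c y → c * (y + x * y) ≡ suc x * (c * y)
  factor = solve-∀

∑<-binomial-derivative : ∀ x a → ∑[ r < suc a ] ((a C r) * (r * x ^ (r ∸ 1))) ≡ a * suc x ^ (a ∸ 1)
∑<-binomial-derivative x zero    = refl
∑<-binomial-derivative x (suc a) = begin
    ∑[ r < suc (suc a) ] ((suc a C r) * ∂ r)
  ≡⟨ ∑<-pascal a ∂ ⟩
    ∑[ r < suc a ] ((a C r) * (∂ r + ∂ (suc r)))
  ≡⟨ ∑<-cong (suc a) (λ r _ → cong ((a C r) *_) (∂-step r)) ⟩
    ∑[ r < suc a ] ((a C r) * (x ^ r + suc x * ∂ r))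
  ≡⟨ ∑<-cong (suc a) (λ r _ → distrib x (a C r) (x ^ r) (∂ r)) ⟩
    ∑[ r < suc a ] ((a C r) * x ^ r + suc x * ((a C r) * ∂ r))
  ≡⟨ ∑<-+ (suc a) (λ r → (a C r) * x ^ r) (λ r → suc x * ((a C r) * ∂ r)) ⟩
    ∑[ r < suc a ] ((a C r) * x ^ r) + ∑[ r < suc a ] (suc x * ((a C r) * ∂ r))
  ≡⟨ cong₂ _+_ (∑<-binomial x a)
       (trans (∑<-*ˡ (suc a) (suc x) (λ r → (a C r) * ∂ r))
              (cong (suc x *_) (∑<-binomial-derivative x a))) ⟩
    suc x ^ a + suc x * (a * suc x ^ (a ∸ 1))
  ≡⟨ collect a ⟩
    suc a * suc x ^ a
  ∎
  where
  open ≡-Reasoning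
  ∂ : ℕ → ℕ
  ∂ r = r * x ^ (r ∸ 1)
  ∂-step : ∀ r → ∂ r + ∂ (suc r) ≡ x ^ r + suc x * ∂ r
  ∂-step zero    = cong suc (sym (*-zeroʳ x))
  ∂-step (suc r) = lemma x r (x ^ r)
    where
    lemma : ∀ x r y → suc r * y + suc (suc r) * (x * y) ≡ x * y + suc x * (suc r * y)
    lemma = solve-∀
  distrib : ∀ x c y z → c * (y + suc x * z) ≡ c * y + suc x * (c * z)
  distrib = solve-∀
  collect : ∀ a → suc x ^ a + suc x * (a * suc x ^ (a ∸ 1)) ≡ suc a * suc x ^ a
  collect zero    = cong (1 +_) (*-zeroʳ (suc x))
  collect (suc a) = lemma (suc x) a (suc x ^ a)
    where
    lemma : ∀ y a z → y * z + y * (suc a * z) ≡ suc (suc a) * (y * z)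
    lemma = solve-∀

∑∈ : List ℕ → (ℕ → ℕ) → ℕ
∑∈ xs f = sum (map f xs)

syntax ∑∈ xs (λ x → e) = ∑[ x ∈ xs ] e

∑∈-cong : ∀ xs {f g : ℕ → ℕ} → (∀ x → f x ≡ g x) → ∑∈ xs f ≡ ∑∈ xs g
∑∈-cong []       f≡g = refl
∑∈-cong (x ∷ xs) f≡g = cong₂ _+_ (f≡g x) (∑∈-cong xs f≡g)

∑∈-cong-local : ∀ {Q : ℕ → Set} {xs} {f g : ℕ → ℕ} → All Q xs → (∀ {x} → Q x → f x ≡ g x) →
  ∑∈ xs f ≡ ∑∈ xs g
∑∈-cong-local []         f≡g = refl
∑∈-cong-local (qx ∷ qxs) f≡g = cong₂ _+_ (f≡g qx) (∑∈-cong-local qxs f≡g)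

∑∈-+ : ∀ xs (f g : ℕ → ℕ) → ∑[ x ∈ xs ] (f x + g x) ≡ ∑∈ xs f + ∑∈ xs g
∑∈-+ []       f g = refl
∑∈-+ (x ∷ xs) f g = trans (cong (f x + g x +_) (∑∈-+ xs f g)) (interchange (f x) (g x) _ _)

∑∈-*ˡ : ∀ xs c (f : ℕ → ℕ) → ∑[ x ∈ xs ] (c * f x) ≡ c * ∑∈ xs f
∑∈-*ˡ []       c f = sym (*-zeroʳ c)
∑∈-*ˡ (x ∷ xs) c f = trans (cong (c * f x +_) (∑∈-*ˡ xs c f)) (sym (*-distribˡ-+ c (f x) _))

∑∈-*ʳ : ∀ xs c (f : ℕ → ℕ) → ∑[ x ∈ xs ] (f x * c) ≡ ∑∈ xs f * c
∑∈-*ʳ xs c f = trans (∑∈-cong xs (λ x → *-comm (f x) c)) (trans (∑∈-*ˡ xs c f) (*-comm c _))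

∑∈-zero : ∀ xs → ∑[ x ∈ xs ] 0 ≡ 0
∑∈-zero []       = refl
∑∈-zero (x ∷ xs) = ∑∈-zero xs

∑∈-map : ∀ xs (g f : ℕ → ℕ) → ∑∈ (map g xs) f ≡ ∑∈ xs (f ∘ g)
∑∈-map []       g f = refl
∑∈-map (x ∷ xs) g f = cong (f (g x) +_) (∑∈-map xs g f)

∑∈-∑< : ∀ xs k (F : ℕ → ℕ → ℕ) → ∑[ x ∈ xs ] ∑[ r < k ] F x r ≡ ∑[ r < k ] ∑[ x ∈ xs ] F x r
∑∈-∑< []       k F = sym (∑<-zero k λ _ _ → refl)
∑∈-∑< (x ∷ xs) k F = trans (cong (∑< k (F x) +_) (∑∈-∑< xs k F)) (sym (∑<-+ k (F x) _))

∑∈-partition : ∀ {P : ℕ → Set} (P? : Decidable P) xs {F A B : ℕ → ℕ} →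
  (∀ {x} → P x → F x ≡ A x) → (∀ {x} → ¬ P x → F x ≡ B x) →
  ∑∈ xs F ≡ ∑∈ (filter P? xs) A + ∑∈ (filter (∁? P?) xs) B
∑∈-partition P? []       FA FB = refl
∑∈-partition {P} P? (x ∷ xs) {F} {A} {B} FA FB = by-cases (P? x)
  where
  IH = ∑∈-partition P? xs FA FB
  goal = F x + ∑∈ xs F ≡ ∑∈ (filter P? (x ∷ xs)) A + ∑∈ (filter (∁? P?) (x ∷ xs)) B
  by-cases : Dec (P x) → goal
  by-cases (yes px) rewrite filter-accept P? {x} {xs} px | filter-reject (∁? P?) {x} {xs} (λ ¬px → ¬px px) =
    trans (cong₂ _+_ (FA px) IH) (sym (+-assoc (A x) _ _))
  by-cases (no ¬px) rewrite filter-reject P? {x} {xs} ¬px | filter-accept (∁? P?) {x} {xs} ¬px =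
    trans (cong₂ _+_ (FB ¬px) IH) (x∙yz≈y∙xz (B x) (∑∈ (filter P? xs) A) _)

sumFromTo≡∑< : ∀ a b (f : ℕ → ℕ) → sumFromTo a b f ≡ ∑[ d < suc b ∸ a ] f (a + d)
sumFromTo≡∑< a b f = ∑∈-applyUpTo (suc b ∸ a) id
  where
  ∑∈-applyUpTo : ∀ k (g : ℕ → ℕ) → ∑[ d ∈ applyUpTo g k ] f (a + d) ≡ ∑[ d < k ] f (a + g d)
  ∑∈-applyUpTo zero    g = refl
  ∑∈-applyUpTo (suc k) g = cong (f (a + g 0) +_) (∑∈-applyUpTo k (g ∘ suc))

sumFromTo-cong : ∀ a b {f g : ℕ → ℕ} → (∀ i → a ≤ i → i ≤ b → f i ≡ g i) →
  sumFromTo a b f ≡ sumFromTo a b g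
sumFromTo-cong a b {f} {g} f≡g = trans (sumFromTo≡∑< a b f) (trans
  (∑<-cong (suc b ∸ a) λ d d<k → f≡g (a + d) (m≤m+n a d) (a+d≤b d d<k))
  (sym (sumFromTo≡∑< a b g)))
  where
  a+d≤b : ∀ d → d < suc b ∸ a → a + d ≤ b
  a+d≤b d d<k =
    ≤-pred (subst (_≤ suc b) (cong suc (+-comm d a)) (m≤o∸n⇒m+n≤o (suc d) (<⇒≤ a<1+b) d<k))
    where
    a<1+b : a < suc b
    a<1+b = m∸n≢0⇒n<m λ eq → contradiction (subst (suc d ≤_) eq d<k) λ ()

sumFromTo-unfold : ∀ a b (f : ℕ → ℕ) → a ≤ b → sumFromTo a b f ≡ f a + sumFromTo (suc a) b f
sumFromTo-unfold a b f a≤b = begin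
    sumFromTo a b f
  ≡⟨ sumFromTo≡∑< a b f ⟩
    ∑[ d < suc b ∸ a ] f (a + d)
  ≡⟨ cong (λ k → ∑[ d < k ] f (a + d)) (+-∸-assoc 1 a≤b) ⟩
    f (a + 0) + ∑[ d < b ∸ a ] f (a + suc d)
  ≡⟨ cong₂ _+_ (cong f (+-identityʳ a)) (∑<-cong (b ∸ a) λ d _ → cong f (+-suc a d)) ⟩
    f a + ∑[ d < b ∸ a ] f (suc a + d)
  ≡⟨ cong (f a +_) (sumFromTo≡∑< (suc a) b f) ⟨
    f a + sumFromTo (suc a) b f
  ∎
  where open ≡-Reasoning

sumFromTo-empty : ∀ a b (f : ℕ → ℕ) → b < a → sumFromTo a b f ≡ 0
sumFromTo-empty a b f b<a =
  trans (sumFromTo≡∑< a b f) (cong (λ k → ∑[ d < k ] f (a + d)) (m≤n⇒m∸n≡0 b<a))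

sumFromTo-dropZeros : ∀ a c b (f : ℕ → ℕ) → a ≤ c → c ≤ suc b → (∀ i → a ≤ i → i < c → f i ≡ 0) →
  sumFromTo a b f ≡ sumFromTo c b f
sumFromTo-dropZeros a c b f a≤c c≤1+b f≡0 =
  trans (drop (c ∸ a) a (subst (_≤ suc b) (sym a+[c∸a]≡c) c≤1+b)
               λ i a≤i i< → f≡0 i a≤i (subst (i <_) a+[c∸a]≡c i<))
        (cong (λ c → sumFromTo c b f) a+[c∸a]≡c)
  where
  a+[c∸a]≡c = m+[n∸m]≡n a≤c
  drop : ∀ e a → a + e ≤ suc b → (∀ i → a ≤ i → i < a + e → f i ≡ 0) →
    sumFromTo a b f ≡ sumFromTo (a + e) b f
  drop zero    a _      _   = cong (λ c → sumFromTo c b f) (sym (+-identityʳ a))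
  drop (suc e) a a+e≤b f≡0 = begin
      sumFromTo a b f
    ≡⟨ sumFromTo-unfold a b f (≤-pred (<-≤-trans a<a+1+e a+e≤b)) ⟩
      f a + sumFromTo (suc a) b f
    ≡⟨ cong₂ _+_ (f≡0 a ≤-refl a<a+1+e)
         (drop e (suc a) (subst (_≤ suc b) (+-suc a e) a+e≤b)
           λ i 1+a≤i i< → f≡0 i (<⇒≤ 1+a≤i) (subst (i <_) (sym (+-suc a e)) i<)) ⟩
      sumFromTo (suc a + e) b f
    ≡⟨ cong (λ c → sumFromTo c b f) (+-suc a e) ⟨
      sumFromTo (a + suc e) b f
    ∎
    where
    open ≡-Reasoning
    a<a+1+e : a < a + suc e
    a<a+1+e = m<m+n a (s≤s z≤n)

∑words : List ℕ → ℕ → (List ℕ → ℕ) → ℕ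
∑words vs zero    F = F []
∑words vs (suc m) F = ∑[ x ∈ vs ] ∑words vs m (F ∘ (x ∷_))

∑words-cong : ∀ vs m {F G : List ℕ → ℕ} → (∀ L → F L ≡ G L) → ∑words vs m F ≡ ∑words vs m G
∑words-cong vs zero    F≡G = F≡G []
∑words-cong vs (suc m) F≡G = ∑∈-cong vs (λ x → ∑words-cong vs m (F≡G ∘ (x ∷_)))

∑words-cong-local : ∀ {Q : ℕ → Set} vs m {F G : List ℕ → ℕ} → All Q vs →
  (∀ {L} → All Q L → length L ≡ m → F L ≡ G L) → ∑words vs m F ≡ ∑words vs m G
∑words-cong-local vs zero    qs F≡G = F≡G [] refl
∑words-cong-local vs (suc m) qs F≡G =
  ∑∈-cong-local qs (λ qx → ∑words-cong-local vs m qs (λ qL |L| → F≡G (qx ∷ qL) (cong suc |L|)))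

∑words-+ : ∀ vs m (F G : List ℕ → ℕ) →
  ∑words vs m (λ L → F L + G L) ≡ ∑words vs m F + ∑words vs m G
∑words-+ vs zero    F G = refl
∑words-+ vs (suc m) F G =
  trans (∑∈-cong vs (λ x → ∑words-+ vs m (F ∘ (x ∷_)) (G ∘ (x ∷_)))) (∑∈-+ vs _ _)

∑words-zero : ∀ vs m → ∑words vs m (λ _ → 0) ≡ 0
∑words-zero vs zero    = refl
∑words-zero vs (suc m) = trans (∑∈-cong vs (λ x → ∑words-zero vs m)) (∑∈-zero vs)

∑words-zero-local : ∀ {Q : ℕ → Set} vs m {F : List ℕ → ℕ} → All Q vs →
  (∀ {L} → All Q L → length L ≡ m → F L ≡ 0) → ∑words vs m F ≡ 0
∑words-zero-local vs m qs F≡0 = trans (∑words-cong-local vs m qs F≡0) (∑words-zero vs m)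

∑words-∑∈ : ∀ vs m is (F : ℕ → List ℕ → ℕ) →
  ∑words vs m (λ L → ∑[ i ∈ is ] F i L) ≡ ∑[ i ∈ is ] ∑words vs m (F i)
∑words-∑∈ vs m []       F = ∑words-zero vs m
∑words-∑∈ vs m (i ∷ is) F =
  trans (∑words-+ vs m (F i) (λ L → ∑[ i ∈ is ] F i L))
        (cong (∑words vs m (F i) +_) (∑words-∑∈ vs m is F))

∑words-map : ∀ vs m (g : ℕ → ℕ) (F : List ℕ → ℕ) →
  ∑words (map g vs) m F ≡ ∑words vs m (F ∘ map g)
∑words-map vs zero    g F = refl
∑words-map vs (suc m) g F =
  trans (∑∈-map vs g _) (∑∈-cong vs (λ x → ∑words-map vs m g (F ∘ (g x ∷_))))

∑words-singleton : ∀ v m → ∑words (v ∷ []) m (λ _ → 1) ≡ 1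
∑words-singleton v zero    = refl
∑words-singleton v (suc m) = trans (+-identityʳ _) (∑words-singleton v m)

∑words-partition-∷ : ∀ {P : ℕ → Set} (P? : Decidable P) vs m (g h : List ℕ → ℕ) →
  ∑words vs (suc m) (λ L → g (filter P? L) * h (filter (∁? P?) L)) ≡
    ∑[ x ∈ filter P? vs ] ∑words vs m (λ L → g (x ∷ filter P? L) * h (filter (∁? P?) L))
      + ∑[ x ∈ filter (∁? P?) vs ] ∑words vs m (λ L → g (filter P? L) * h (x ∷ filter (∁? P?) L))
∑words-partition-∷ P? vs m g h = ∑∈-partition P? vs
  (λ px → ∑words-cong vs m λ L → cong₂ (λ u v → g u * h v)
            (filter-accept P? px) (filter-reject (∁? P?) (λ ¬px → ¬px px)))
  (λ ¬px → ∑words-cong vs m λ L → cong₂ (λ u v → g u * h v)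
             (filter-reject P? ¬px) (filter-accept (∁? P?) ¬px))

-- A word is its subword of letters in P, its subword of letters outside P, and the choice of
-- the (m C r) sets of positions holding the former.
∑words-partition : ∀ {P : ℕ → Set} (P? : Decidable P) vs m (g h : List ℕ → ℕ) →
  ∑words vs m (λ L → g (filter P? L) * h (filter (∁? P?) L)) ≡
  ∑[ r < suc m ] ((m C r) * (∑words (filter P? vs) r g * ∑words (filter (∁? P?) vs) (m ∸ r) h))
∑words-partition P? vs zero    g h = sym (trans (+-identityʳ _) (+-identityʳ _))
∑words-partition P? vs (suc m) g h = begin
    ∑words vs (suc m) (λ L → g (filter P? L) * h (filter (∁? P?) L))
  ≡⟨ ∑words-partition-∷ P? vs m g h ⟩
    ∑[ x ∈ V ] ∑words vs m (λ L → g (x ∷ filter P? L) * h (filter (∁? P?) L))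
      + ∑[ x ∈ W ] ∑words vs m (λ L → g (filter P? L) * h (x ∷ filter (∁? P?) L))
  ≡⟨ cong₂ _+_ (∑∈-cong V (λ x → ∑words-partition P? vs m (g ∘ (x ∷_)) h))
               (∑∈-cong W (λ x → ∑words-partition P? vs m g (h ∘ (x ∷_)))) ⟩
    ∑[ x ∈ V ] ∑[ r < suc m ] ((m C r) * (∑words V r (g ∘ (x ∷_)) * b (m ∸ r)))
      + ∑[ x ∈ W ] ∑[ r < suc m ] ((m C r) * (a r * ∑words W (m ∸ r) (h ∘ (x ∷_))))
  ≡⟨ cong₂ _+_
       (trans (∑∈-∑< V (suc m) (λ x r → (m C r) * (∑words V r (g ∘ (x ∷_)) * b (m ∸ r))))
              (∑<-cong (suc m) λ r _ → first-letter-in-V r))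
       (trans (∑∈-∑< W (suc m) (λ x r → (m C r) * (a r * ∑words W (m ∸ r) (h ∘ (x ∷_)))))
              (∑<-cong (suc m) λ r _ → first-letter-in-W r)) ⟩
    ∑[ r < suc m ] ((m C r) * f (suc r)) + ∑[ r < suc m ] ((m C r) * (a r * b (suc (m ∸ r))))
  ≡⟨ cong (∑[ r < suc m ] ((m C r) * f (suc r)) +_) (∑<-cong (suc m) λ r r≤m →
       cong (λ k → (m C r) * (a r * b k)) (sym (+-∸-assoc 1 (≤-pred r≤m)))) ⟩
    ∑[ r < suc m ] ((m C r) * f (suc r)) + ∑[ r < suc m ] ((m C r) * f r)
  ≡⟨ +-comm (∑[ r < suc m ] ((m C r) * f (suc r))) _ ⟩
    ∑[ r < suc m ] ((m C r) * f r) + ∑[ r < suc m ] ((m C r) * f (suc r))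
  ≡⟨ ∑<-+ (suc m) (λ r → (m C r) * f r) (λ r → (m C r) * f (suc r)) ⟨
    ∑[ r < suc m ] ((m C r) * f r + (m C r) * f (suc r))
  ≡⟨ ∑<-cong (suc m) (λ r _ → *-distribˡ-+ (m C r) (f r) (f (suc r))) ⟨
    ∑[ r < suc m ] ((m C r) * (f r + f (suc r)))
  ≡⟨ ∑<-pascal m f ⟨
    ∑[ r < suc (suc m) ] ((suc m C r) * f r)
  ∎
  where
  open ≡-Reasoning
  V = filter P? vs
  W = filter (∁? P?) vs
  a b f : ℕ → ℕ
  a r = ∑words V r g
  b r = ∑words W r h
  f r = a r * b (suc m ∸ r)
  first-letter-in-V : ∀ r →
    ∑[ x ∈ V ] ((m C r) * (∑words V r (g ∘ (x ∷_)) * b (m ∸ r))) ≡ (m C r) * f (suc r)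
  first-letter-in-V r = trans (∑∈-*ˡ V (m C r) _) (cong ((m C r) *_) (∑∈-*ʳ V (b (m ∸ r)) _))
  first-letter-in-W : ∀ r →
    ∑[ x ∈ W ] ((m C r) * (a r * ∑words W (m ∸ r) (h ∘ (x ∷_)))) ≡ (m C r) * (a r * b (suc (m ∸ r)))
  first-letter-in-W r = trans (∑∈-*ˡ W (m C r) _) (cong ((m C r) *_) (∑∈-*ˡ W (a r) _))

interval : ℕ → ℕ → List ℕ
interval a zero    = []
interval a (suc k) = a ∷ interval (suc a) k

oneTo : ℕ → List ℕ
oneTo = interval 1

InRange : ℕ → ℕ → Set
InRange n x = 1 ≤ x × x ≤ n

interval-bounds : ∀ a k → All (λ x → a ≤ x × x < a + k) (interval a k)
interval-bounds a zero    = []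
interval-bounds a (suc k) = (≤-refl , subst (a <_) (sym (+-suc a k)) (s≤s (m≤m+n a k)))
  ∷ All.map (λ {x} (a<x , x<) → <⇒≤ a<x , subst (x <_) (sym (+-suc a k)) x<) (interval-bounds (suc a) k)

oneTo-InRange : ∀ n → All (InRange n) (oneTo n)
oneTo-InRange n = All.map (λ (1≤x , x<1+n) → 1≤x , ≤-pred x<1+n) (interval-bounds 1 n)

interval-++ : ∀ a k l → interval a (k + l) ≡ interval a k ++ interval (a + k) l
interval-++ a zero    l = cong (λ a → interval a l) (sym (+-identityʳ a))
interval-++ a (suc k) l = cong (a ∷_) (trans (interval-++ (suc a) k l)
  (cong (λ b → interval (suc a) k ++ interval b l) (sym (+-suc a k))))

interval-shift : ∀ c a k → map (c +_) (interval a k) ≡ interval (c + a) k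
interval-shift c a zero    = refl
interval-shift c a (suc k) =
  cong ((c + a) ∷_) (trans (interval-shift c (suc a) k) (cong (λ b → interval b k) (+-suc c a)))

oneTo-above : ∀ i e → filter (i <?_) (oneTo (i + e)) ≡ map (i +_) (oneTo e)
oneTo-above i e = begin
    filter (i <?_) (oneTo (i + e))
  ≡⟨ cong (filter (i <?_)) (interval-++ 1 i e) ⟩
    filter (i <?_) (interval 1 i ++ interval (1 + i) e)
  ≡⟨ filter-++ (i <?_) (interval 1 i) _ ⟩
    filter (i <?_) (interval 1 i) ++ filter (i <?_) (interval (1 + i) e)
  ≡⟨ cong₂ _++_ (filter-none (i <?_) (All.map (≤⇒≯ ∘ proj₂) (oneTo-InRange i)))
                (filter-all (i <?_) (All.map proj₁ (interval-bounds (1 + i) e))) ⟩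
    interval (1 + i) e
  ≡⟨ cong (λ a → interval a e) (+-comm 1 i) ⟩
    interval (i + 1) e
  ≡⟨ interval-shift i 1 e ⟨
    map (i +_) (oneTo e)
  ∎
  where open ≡-Reasoning

oneTo-notAbove : ∀ i e → filter (∁? (i <?_)) (oneTo (i + e)) ≡ oneTo i
oneTo-notAbove i e = begin
    filter (∁? (i <?_)) (oneTo (i + e))
  ≡⟨ cong (filter (∁? (i <?_))) (interval-++ 1 i e) ⟩
    filter (∁? (i <?_)) (interval 1 i ++ interval (1 + i) e)
  ≡⟨ filter-++ (∁? (i <?_)) (interval 1 i) _ ⟩
    filter (∁? (i <?_)) (interval 1 i) ++ filter (∁? (i <?_)) (interval (1 + i) e)
  ≡⟨ cong₂ _++_ (filter-all (∁? (i <?_)) (All.map (≤⇒≯ ∘ proj₂) (oneTo-InRange i)))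
                (filter-none (∁? (i <?_)) (All.map (λ (i<x , _) i≮x → i≮x i<x) (interval-bounds (1 + i) e))) ⟩
    interval 1 i ++ []
  ≡⟨ ++-identityʳ (interval 1 i) ⟩
    oneTo i
  ∎
  where open ≡-Reasoning

∑words-oneTo-split : ∀ i e m (g h : List ℕ → ℕ) →
  ∑words (oneTo (i + e)) m (λ L → g (filter (i <?_) L) * h (filter (∁? (i <?_)) L)) ≡
  ∑[ r < suc m ] ((m C r) * (∑words (map (i +_) (oneTo e)) r g * ∑words (oneTo i) (m ∸ r) h))
∑words-oneTo-split i e m g h = trans (∑words-partition (i <?_) (oneTo (i + e)) m g h)
  (∑<-cong (suc m) λ r _ → cong₂ (λ U V → (m C r) * (∑words U r g * ∑words V (m ∸ r) h))
                                   (oneTo-above i e) (oneTo-notAbove i e))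

∑words-++-unused : ∀ {Q : ℕ → Set} vs ws m (F : List ℕ → ℕ) → All (∁ Q) ws →
  (∀ {L} → ¬ All Q L → F L ≡ 0) → ∑words (vs ++ ws) m F ≡ ∑words vs m F
∑words-++-unused vs ws zero    F ws∉Q F≡0 = refl
∑words-++-unused vs ws (suc m) F ws∉Q F≡0 = begin
    ∑[ x ∈ vs ++ ws ] ∑words (vs ++ ws) m (F ∘ (x ∷_))
  ≡⟨ trans (cong sum (map-++ _ vs ws)) (sum-++ (map _ vs) _) ⟩
    ∑[ x ∈ vs ] ∑words (vs ++ ws) m (F ∘ (x ∷_)) + ∑[ x ∈ ws ] ∑words (vs ++ ws) m (F ∘ (x ∷_))
  ≡⟨ cong₂ _+_
       (∑∈-cong vs λ x → ∑words-++-unused vs ws m (F ∘ (x ∷_)) ws∉Q (λ ¬QL → F≡0 (¬QL ∘ All.tail)))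
       (trans (∑∈-cong-local ws∉Q λ ¬Qx →
                 trans (∑words-cong (vs ++ ws) m λ L → F≡0 (¬Qx ∘ All.head)) (∑words-zero (vs ++ ws) m))
              (∑∈-zero ws)) ⟩
    ∑[ x ∈ vs ] ∑words vs m (F ∘ (x ∷_)) + 0
  ≡⟨ +-identityʳ _ ⟩
    ∑[ x ∈ vs ] ∑words vs m (F ∘ (x ∷_))
  ∎
  where open ≡-Reasoning

𝟙 : {A : Set} → Dec A → ℕ
𝟙 (yes _) = 1
𝟙 (no _)  = 0

𝟙-yes : ∀ {A : Set} (A? : Dec A) → A → 𝟙 A? ≡ 1
𝟙-yes (yes _) _ = refl
𝟙-yes (no ¬a) a = contradiction a ¬a

𝟙-no : ∀ {A : Set} (A? : Dec A) → ¬ A → 𝟙 A? ≡ 0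
𝟙-no (yes a) ¬a = contradiction a ¬a
𝟙-no (no _)  _  = refl

𝟙-cong : ∀ {A B : Set} (A? : Dec A) (B? : Dec B) → A ⇔ B → 𝟙 A? ≡ 𝟙 B?
𝟙-cong (yes a) B? A⇔B = sym (𝟙-yes B? (Equivalence.to A⇔B a))
𝟙-cong (no ¬a) B? A⇔B = sym (𝟙-no B? (¬a ∘ Equivalence.from A⇔B))

𝟙-× : ∀ {A B : Set} (A? : Dec A) (B? : Dec B) → 𝟙 (A? ×-dec B?) ≡ 𝟙 A? * 𝟙 B?
𝟙-× (yes _) (yes _) = refl
𝟙-× (yes _) (no _)  = refl
𝟙-× (no _)  _       = refl

𝟙-yes-× : ∀ {A B : Set} (A? : Dec A) (B? : Dec B) → A → 𝟙 (A? ×-dec B?) ≡ 𝟙 B?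
𝟙-yes-× A? B? a = 𝟙-cong (A? ×-dec B?) B? (mk⇔ proj₂ (a ,_))

𝟙-split : ∀ {A B : Set} (A? : Dec A) (B? : Dec B) → 𝟙 A? ≡ 𝟙 (A? ×-dec B?) + 𝟙 (A? ×-dec ¬? B?)
𝟙-split (yes _) (yes _) = refl
𝟙-split (yes _) (no _)  = refl
𝟙-split (no _)  _       = refl

𝟙↔Fin : ∀ {A : Set} (A? : Dec A) → Irrelevant A → A ↔ Fin (𝟙 A?)
𝟙↔Fin (yes a) irr = mk↔ₛ′ (λ _ → Fin.zero) (λ _ → a) (λ { Fin.zero → refl ; (Fin.suc ()) }) (irr a)
𝟙↔Fin (no ¬a) irr = mk↔ₛ′ (λ a → contradiction a ¬a) (λ ()) (λ ()) (λ a → contradiction a ¬a)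

Fin-cong : ∀ {a b} → a ≡ b → Fin a ↔ Fin b
Fin-cong refl = ↔-refl

NoneBelow : (ℕ → Set) → ℕ → Set
NoneBelow t i = ∀ {k} → k < i → ¬ t k

NoneBelow? : ∀ {t : ℕ → Set} → Decidable t → Decidable (NoneBelow t)
NoneBelow? t? = allUpTo? (∁? t?)

NoneBelow-suc⇔ : ∀ {t : ℕ → Set} i → (NoneBelow t i × ¬ t i) ⇔ NoneBelow t (suc i)
NoneBelow-suc⇔ {t} i = mk⇔ extend (λ none → none ∘ m≤n⇒m≤1+n , none ≤-refl)
  where
  extend : NoneBelow t i × ¬ t i → NoneBelow t (suc i)
  extend (none , ¬ti) {k} k<1+i with m<1+n⇒m<n∨m≡n k<1+i
  ... | inj₁ k<i  = none k<i
  ... | inj₂ refl = ¬ti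

-- Classify by the least i ≥ a at which t holds; there is one, at most a + e.
𝟙-NoneBelow≡∑first : ∀ {t : ℕ → Set} (t? : Decidable t) e a → t (a + e) →
  𝟙 (NoneBelow? t? a) ≡ sumFromTo a (a + e) (λ i → 𝟙 (NoneBelow? t? i ×-dec t? i))
𝟙-NoneBelow≡∑first {t} t? zero    a ta = begin
    𝟙 (NoneBelow? t? a)
  ≡⟨ 𝟙-cong (NoneBelow? t? a) (NoneBelow? t? a ×-dec t? a) (mk⇔ (_, subst t (+-identityʳ a) ta) proj₁) ⟩
    g a
  ≡⟨ +-identityʳ (g a) ⟨
    g a + 0
  ≡⟨ cong (g a +_) (sumFromTo-empty (suc a) (a + 0) g (s≤s (≤-reflexive (+-identityʳ a)))) ⟨
    g a + sumFromTo (suc a) (a + 0) g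
  ≡⟨ sumFromTo-unfold a (a + 0) g (m≤m+n a 0) ⟨
    sumFromTo a (a + 0) g
  ∎
  where
  open ≡-Reasoning
  g : ℕ → ℕ
  g i = 𝟙 (NoneBelow? t? i ×-dec t? i)
𝟙-NoneBelow≡∑first {t} t? (suc e) a ta+1+e = begin
    𝟙 (NoneBelow? t? a)
  ≡⟨ 𝟙-split (NoneBelow? t? a) (t? a) ⟩
    g a + 𝟙 (NoneBelow? t? a ×-dec ¬? (t? a))
  ≡⟨ cong (g a +_) (trans
       (𝟙-cong (NoneBelow? t? a ×-dec ¬? (t? a)) (NoneBelow? t? (suc a)) (NoneBelow-suc⇔ a))
       (𝟙-NoneBelow≡∑first t? e (suc a) (subst t (+-suc a e) ta+1+e))) ⟩
    g a + sumFromTo (suc a) (suc a + e) g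
  ≡⟨ cong (λ b → g a + sumFromTo (suc a) b g) (+-suc a e) ⟨
    g a + sumFromTo (suc a) (a + suc e) g
  ≡⟨ sumFromTo-unfold a (a + suc e) g (m≤m+n a (suc e)) ⟨
    sumFromTo a (a + suc e) g
  ∎
  where
  open ≡-Reasoning
  g : ℕ → ℕ
  g i = 𝟙 (NoneBelow? t? i ×-dec t? i)

𝟙-×-NoneBelow≡∑first : ∀ {A : Set} {t : ℕ → Set} (A? : Dec A) (t? : Decidable t) a b →
  a ≤ b → (A → t b) →
  𝟙 (A? ×-dec NoneBelow? t? a) ≡ sumFromTo a b (λ i → 𝟙 (A? ×-dec (NoneBelow? t? i ×-dec t? i)))
𝟙-×-NoneBelow≡∑first {t = t} A? t? a b a≤b A⇒tb with A?
... | no _  = sym (∑∈-zero (applyUpTo id (suc b ∸ a)))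
... | yes x = begin
    𝟙 (yes x ×-dec NoneBelow? t? a)
  ≡⟨ 𝟙-yes-× (yes x) (NoneBelow? t? a) x ⟩
    𝟙 (NoneBelow? t? a)
  ≡⟨ 𝟙-NoneBelow≡∑first t? (b ∸ a) a (subst t (sym a+[b∸a]≡b) (A⇒tb x)) ⟩
    sumFromTo a (a + (b ∸ a)) first-at
  ≡⟨ cong (λ c → sumFromTo a c first-at) a+[b∸a]≡b ⟩
    sumFromTo a b first-at
  ≡⟨ ∑∈-cong (applyUpTo id (suc b ∸ a)) (λ d → 𝟙-yes-× (yes x) (first-at? (a + d)) x) ⟨
    sumFromTo a b (λ i → 𝟙 (yes x ×-dec first-at? i))
  ∎
  where
  open ≡-Reasoning
  a+[b∸a]≡b = m+[n∸m]≡n a≤b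
  first-at? : ∀ i → Dec (NoneBelow t i × t i)
  first-at? i = NoneBelow? t? i ×-dec t? i
  first-at : ℕ → ℕ
  first-at i = 𝟙 (first-at? i)

Σℕ-split-least : ∀ {B : ℕ → Set} a → (∀ {x} → B x → a ≤ x) →
  Σ ℕ B ↔ (B a ⊎ Σ ℕ (λ x → a < x × B x))
Σℕ-split-least {B} a least = mk↔ₛ′ to from to∘from from∘to
  where
  split : ∀ x → B x → Dec (x ≡ a) → B a ⊎ Σ ℕ (λ x → a < x × B x)
  split x b (yes refl) = inj₁ b
  split x b (no x≢a)   = inj₂ (x , ≤∧≢⇒< (least b) (x≢a ∘ sym) , b)
  to : Σ ℕ B → B a ⊎ Σ ℕ (λ x → a < x × B x)
  to (x , b) = split x b (x ≟ a)
  from : B a ⊎ Σ ℕ (λ x → a < x × B x) → Σ ℕ B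
  from (inj₁ b)           = a , b
  from (inj₂ (x , _ , b)) = x , b
  split-least : ∀ b (a≟a : Dec (a ≡ a)) → split a b a≟a ≡ inj₁ b
  split-least b (yes refl) = refl
  split-least b (no a≢a)   = contradiction refl a≢a
  split-above : ∀ x b (a<x : a < x) (x≟a : Dec (x ≡ a)) → split x b x≟a ≡ inj₂ (x , a<x , b)
  split-above x b a<x (yes refl) = contradiction a<x (<-irrefl refl)
  split-above x b a<x (no _)     = cong (λ a<x → inj₂ (x , a<x , b)) (<-irrelevant _ a<x)
  to∘from : ∀ y → to (from y) ≡ y
  to∘from (inj₁ b)             = split-least b (a ≟ a)
  to∘from (inj₂ (x , a<x , b)) = split-above x b a<x (x ≟ a)
  from-split : ∀ x b (x≟a : Dec (x ≡ a)) → from (split x b x≟a) ≡ (x , b)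
  from-split x b (yes refl) = refl
  from-split x b (no _)     = refl
  from∘to : ∀ p → from (to p) ≡ p
  from∘to (x , b) = from-split x b (x ≟ a)

Σℕ↔Fin-∑interval : ∀ {B : ℕ → Set} a k (f : ℕ → ℕ) → (∀ {x} → B x → a ≤ x × x < a + k) →
  (∀ x → a ≤ x → B x ↔ Fin (f x)) → Σ ℕ B ↔ Fin (∑[ x ∈ interval a k ] f x)
Σℕ↔Fin-∑interval a zero f bounds B↔f =
  mk↔ₛ′ (λ (x , b) → contradiction (bounds b) out-of-range) (λ ()) (λ ())
        (λ (x , b) → contradiction (bounds b) out-of-range)
  where
  out-of-range : ∀ {x} → ¬ (a ≤ x × x < a + 0)
  out-of-range (a≤x , x<a+0) = <-irrefl refl (<-≤-trans (subst (_ <_) (+-identityʳ a) x<a+0) a≤x)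
Σℕ↔Fin-∑interval {B} a (suc k) f bounds B↔f = begin
    Σ ℕ B
  ↔⟨ Σℕ-split-least a (proj₁ ∘ bounds) ⟩
    (B a ⊎ Σ ℕ (λ x → a < x × B x))
  ↔⟨ B↔f a ≤-refl ⊎-↔ Σℕ↔Fin-∑interval (suc a) k f bounds′ B′↔f ⟩
    (Fin (f a) ⊎ Fin (∑[ x ∈ interval (suc a) k ] f x))
  ↔⟨ +↔⊎ ⟨
    Fin (f a + ∑[ x ∈ interval (suc a) k ] f x)
  ∎
  where
  open Related.EquationalReasoning {k = bijection}
  bounds′ : ∀ {x} → a < x × B x → suc a ≤ x × x < suc a + k
  bounds′ {x} (a<x , b) = a<x , subst (x <_) (+-suc a k) (proj₂ (bounds b))
  B′↔f : ∀ x → suc a ≤ x → (a < x × B x) ↔ Fin (f x)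
  B′↔f x a<x = ↔-trans
    (mk↔ₛ′ proj₂ (a<x ,_) (λ _ → refl) (λ (a<x′ , b) → cong (_, b) (<-irrelevant a<x a<x′)))
    (B↔f x (<⇒≤ a<x))

Σ-Vec-uncons : ∀ m (P : Vec ℕ (suc m) → Set) →
  Σ (Vec ℕ (suc m)) P ↔ Σ ℕ (λ x → Σ (Vec ℕ m) (λ v → P (x ∷ᵥ v)))
Σ-Vec-uncons m P = mk↔ₛ′ (λ { (x ∷ᵥ v , p) → x , v , p }) (λ (x , v , p) → x ∷ᵥ v , p)
                         (λ _ → refl) (λ { (x ∷ᵥ v , p) → refl })

Σ-Vec↔Fin-∑words : ∀ n m (A : List ℕ → Set) (A? : ∀ L → Dec (A L)) → (∀ L → Irrelevant (A L)) →
  (∀ {L} → A L → All (InRange n) L) → Σ (Vec ℕ m) (A ∘ toList) ↔ Fin (∑words (oneTo n) m (𝟙 ∘ A?))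
Σ-Vec↔Fin-∑words n zero A A? irr inRange =
  ↔-trans (mk↔ₛ′ (λ { ([]ᵥ , a) → a }) ([]ᵥ ,_) (λ _ → refl) (λ { ([]ᵥ , a) → refl }))
          (𝟙↔Fin (A? []) (irr []))
Σ-Vec↔Fin-∑words n (suc m) A A? irr inRange =
  ↔-trans (Σ-Vec-uncons m (A ∘ toList))
          (Σℕ↔Fin-∑interval 1 n _ head-in-range
             (λ x _ → Σ-Vec↔Fin-∑words n m (A ∘ (x ∷_)) (A? ∘ (x ∷_)) (irr ∘ (x ∷_))
                                          (All.tail ∘ inRange)))
  where
  head-in-range : ∀ {x} → Σ (Vec ℕ m) (λ v → A (x ∷ toList v)) → 1 ≤ x × x < 1 + n
  head-in-range (v , a) with inRange a
  ... | (1≤x , x≤n) ∷ _ = 1≤x , s≤s x≤n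

-- Parking sequences

#above : ℕ → List ℕ → ℕ
#above k L = ∑[ x ∈ L ] 𝟙 (k <? x)

#above-∷-> : ∀ {k x} L → k < x → #above k (x ∷ L) ≡ suc (#above k L)
#above-∷-> {k} {x} L k<x = cong (_+ #above k L) (𝟙-yes (k <? x) k<x)

#above-∷-≤ : ∀ {k x} L → x ≤ k → #above k (x ∷ L) ≡ #above k L
#above-∷-≤ {k} {x} L x≤k = cong (_+ #above k L) (𝟙-no (k <? x) (≤⇒≯ x≤k))

#above-none : ∀ {k L} → All (_≤ k) L → #above k L ≡ 0
#above-none {L = []}     []           = refl
#above-none {L = x ∷ L} (x≤k ∷ L≤k) = trans (#above-∷-≤ L x≤k) (#above-none L≤k)

#above-all : ∀ {k L} → All (k <_) L → #above k L ≡ length L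
#above-all {L = []}     []           = refl
#above-all {L = x ∷ L} (k<x ∷ k<L) = trans (#above-∷-> L k<x) (cong suc (#above-all k<L))

#above≡0⇒≤ : ∀ k L → #above k L ≡ 0 → All (_≤ k) L
#above≡0⇒≤ k []      _  = []
#above≡0⇒≤ k (x ∷ L) eq with k <? x
... | no x≯k = ≮⇒≥ x≯k ∷ #above≡0⇒≤ k L eq

#above≤length : ∀ k L → #above k L ≤ length L
#above≤length k []      = z≤n
#above≤length k (x ∷ L) with k <? x
... | yes _ = s≤s (#above≤length k L)
... | no _  = m≤n⇒m≤1+n (#above≤length k L)

#above-partition : ∀ {P : ℕ → Set} (P? : Decidable P) k L →
  #above k L ≡ #above k (filter P? L) + #above k (filter (∁? P?) L)
#above-partition P? k L = ∑∈-partition P? L (λ _ → refl) (λ _ → refl)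

#above-shift : ∀ c k L → #above (c + k) (map (c +_) L) ≡ #above k L
#above-shift c k L = trans (∑∈-map L (c +_) _)
  (∑∈-cong L λ x → 𝟙-cong (c + k <? c + x) (k <? x) (mk⇔ (+-cancelˡ-< c k x) (+-monoʳ-< c)))

#above-↭ : ∀ k {L L′} → L ↭ L′ → #above k L ≡ #above k L′
#above-↭ k L↭L′ = sum-↭ (map⁺ (λ x → 𝟙 (k <? x)) L↭L′)

#above-ignores-below : ∀ i k L → i ≤ k → #above k L ≡ #above k (filter (i <?_) L)
#above-ignores-below i k L i≤k = trans (#above-partition (i <?_) k L)
  (trans (cong (#above k (filter (i <?_) L) +_) (#above-none (All.map (λ i≮x → ≤-trans (≮⇒≥ i≮x) i≤k)
           (all-filter (∁? (i <?_)) L))))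
         (+-identityʳ _))

#above-below-threshold : ∀ i k L → k ≤ i →
  #above k L ≡ #above k (filter (∁? (i <?_)) L) + length (filter (i <?_) L)
#above-below-threshold i k L k≤i = trans (#above-partition (i <?_) k L)
  (trans (+-comm (#above k (filter (i <?_) L)) _)
         (cong (#above k (filter (∁? (i <?_)) L) +_)
               (#above-all (All.map (≤-<-trans k≤i) (all-filter (i <?_) L)))))

-- Parking b L is the classical criterion for L, with entries in [1, b], to park on b spots;
-- ParkingAbove c b applies it to the entries of L shifted down by c.
ParkingAbove : ℕ → ℕ → List ℕ → Set
ParkingAbove c b L = ∀ k → k ≤ b → #above (c + k) L + k ≤ b

Parking : ℕ → List ℕ → Set
Parking = ParkingAbove 0

ParkingAbove? : ∀ c b L → Dec (ParkingAbove c b L)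
ParkingAbove? c b L = map′ (λ h k k≤b → h {k} (s≤s k≤b)) (λ h {k} k<1+b → h k (≤-pred k<1+b))
  (allUpTo? (λ k → #above (c + k) L + k ≤? b) (suc b))

Parking? : ∀ b L → Dec (Parking b L)
Parking? = ParkingAbove? 0

Parking⇒≤ : ∀ {b L} → Parking b L → All (_≤ b) L
Parking⇒≤ {b} {L} parks = #above≡0⇒≤ b L (n≤0⇒n≡0 (+-cancelʳ-≤ b (#above b L) 0 (parks b ≤-refl)))

Parking⇒length≤ : ∀ {b L} → All (1 ≤_) L → Parking b L → length L ≤ b
Parking⇒length≤ {L = L} 1≤L parks = subst (_≤ _) (trans (+-identityʳ _) (#above-all 1≤L)) (parks 0 z≤n)

Parking-↭ : ∀ {b L L′} → L ↭ L′ → Parking b L → Parking b L′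
Parking-↭ L↭L′ parks k k≤b = subst (λ a → a + k ≤ _) (#above-↭ k L↭L′) (parks k k≤b)

ParkingAbove-shift : ∀ c b L → ParkingAbove c b (map (c +_) L) ⇔ Parking b L
ParkingAbove-shift c b L = mk⇔
  (λ parks k k≤b → subst (λ a → a + k ≤ b) (#above-shift c k L) (parks k k≤b))
  (λ parks k k≤b → subst (λ a → a + k ≤ b) (sym (#above-shift c k L)) (parks k k≤b))

Parking-∷⁻ : ∀ {b x L} → Parking b (x ∷ L) → Parking b L
Parking-∷⁻ {x = x} {L} parks k k≤b =
  ≤-trans (+-monoˡ-≤ k (m≤n+m (#above k L) (𝟙 (k <? x)))) (parks k k≤b)

≤ᵇ⇔≤ : ∀ m n → T (m ≤ᵇ n) ⇔ m ≤ n
≤ᵇ⇔≤ m n = mk⇔ (≤ᵇ⇒≤ m n) ≤⇒≤ᵇ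

Parking-sorted-∷ : ∀ b x xs → All (x ≤_) xs →
  Parking (suc b + length xs) (x ∷ xs) ⇔ (x ≤ suc b × Parking (suc b + length xs) xs)
Parking-sorted-∷ b x xs x≤xs = mk⇔ (λ parks → head-fits parks , Parking-∷⁻ {x = x} {xs} parks) cons-parks
  where
  N = suc b + length xs
  all-above : ∀ {k} → k < x → #above k (x ∷ xs) ≡ suc (length xs)
  all-above k<x = #above-all (k<x ∷ All.map (<-≤-trans k<x) x≤xs)
  head-fits : Parking N (x ∷ xs) → x ≤ suc b
  head-fits parks with x ≤? suc b
  ... | yes x≤1+b = x≤1+b
  ... | no x≰1+b  = contradiction
    (subst (λ a → a + suc b ≤ N) (all-above (≰⇒> x≰1+b)) (parks (suc b) (m≤m+n (suc b) (length xs))))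
    (<⇒≱ (s≤s (≤-reflexive (+-comm (suc b) (length xs)))))
  cons-parks : x ≤ suc b × Parking N xs → Parking N (x ∷ xs)
  cons-parks (x≤1+b , parks) k k≤N = by-cases (k <? x)
    where
    by-cases : Dec (k < x) → #above k (x ∷ xs) + k ≤ N
    by-cases (yes k<x) = subst (λ a → a + k ≤ N) (sym (all-above k<x))
                           (s≤s (≤-trans (+-monoʳ-≤ (length xs) (≤-pred (≤-trans k<x x≤1+b)))
                                         (≤-reflexive (+-comm (length xs) b))))
    by-cases (no k≮x)  = subst (λ a → a + k ≤ N) (sym (#above-∷-≤ xs (≮⇒≥ k≮x))) (parks k k≤N)

boundsOK⇔Parking : ∀ b s → Sorted s → T (boundsOK (suc b) s) ⇔ Parking (b + length s) s
boundsOK⇔Parking b []      _      = mk⇔ (λ _ k k≤b → k≤b) (λ _ → tt)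
boundsOK⇔Parking b (x ∷ xs) sorted = ⇔.trans
  (⇔.trans T-∧ (≤ᵇ⇔≤ x (suc b) ×-⇔ boundsOK⇔Parking (suc b) xs (Linked.tail sorted)))
  (subst (λ N → (x ≤ suc b × Parking (suc b + length xs) xs) ⇔ Parking N (x ∷ xs))
         (sym (+-suc b (length xs)))
         (⇔.sym (Parking-sorted-∷ b x xs (sorted-head sorted))))
  where
  sorted-head : Sorted (x ∷ xs) → All (x ≤_) xs
  sorted-head Linked.[-]            = []
  sorted-head (x≤y Linked.∷ sorted) = Linked⇒All ≤-trans x≤y sorted

inRange⇔ : ∀ n x → T (inRange n x) ⇔ InRange n x
inRange⇔ n x = ⇔.trans T-∧ (≤ᵇ⇔≤ 1 x ×-⇔ ≤ᵇ⇔≤ x n)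

isPF⇔inRange×boundsOK : ∀ m n L →
  T (isPF m n L) ⇔ (All (InRange n) L × T (boundsOK (suc (n ∸ m)) (sort L)))
isPF⇔inRange×boundsOK m n L = ⇔.trans T-∧ (mk⇔
  (All.map (Equivalence.to (inRange⇔ n _)) ∘ all⁺ (inRange n) L)
  (all⁻ (inRange n) ∘ All.map (Equivalence.from (inRange⇔ n _))) ×-⇔ ⇔.refl)

isPF⇒InRange : ∀ m n L → T (isPF m n L) → All (InRange n) L
isPF⇒InRange m n L = proj₁ ∘ Equivalence.to (isPF⇔inRange×boundsOK m n L)

isPF⇔ : ∀ m n L → length L ≡ m → m ≤ n → T (isPF m n L) ⇔ (All (InRange n) L × Parking n L)
isPF⇔ m n L |L|≡m m≤n = ⇔.trans (isPF⇔inRange×boundsOK m n L) (⇔.refl ×-⇔ mk⇔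
  (Parking-↭ (sort-↭ L) ∘ Equivalence.to sorted-parks)
  (Equivalence.from sorted-parks ∘ Parking-↭ (↭-sym (sort-↭ L))))
  where
  sorted-parks : T (boundsOK (suc (n ∸ m)) (sort L)) ⇔ Parking n (sort L)
  sorted-parks = subst (λ N → T (boundsOK (suc (n ∸ m)) (sort L)) ⇔ Parking N (sort L))
    (trans (cong (n ∸ m +_) (trans (↭-length (sort-↭ L)) |L|≡m)) (m∸n+n≡m m≤n))
    (boundsOK⇔Parking (n ∸ m) (sort L) (sort-↗ L))

-- The number of parking functions

-- (b + 1 − a)(b + 1)^(a − 1), with the value 1 at a = 0 and 0 once a > b.
parkingFormula : ℕ → ℕ → ℕ
parkingFormula zero    b = 1
parkingFormula (suc a) b = (b ∸ a) * suc b ^ a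

parkingFormula-tooMany : ∀ a b → b < a → parkingFormula a b ≡ 0
parkingFormula-tooMany (suc a) b (s≤s b≤a) = cong (_* suc b ^ a) (m≤n⇒m∸n≡0 b≤a)

parkingFormula-diag : ∀ e → parkingFormula e e ≡ suc e ^ (e ∸ 1)
parkingFormula-diag zero    = refl
parkingFormula-diag (suc e) = trans (cong (_* suc (suc e) ^ e) (m+n∸n≡m 1 e)) (*-identityˡ _)

parkingFormula-deficit : ∀ a b → a ≤ suc b → parkingFormula a b + a * suc b ^ (a ∸ 1) ≡ suc b ^ a
parkingFormula-deficit zero    b _         = refl
parkingFormula-deficit (suc a) b (s≤s a≤b) = begin
    (b ∸ a) * suc b ^ a + suc a * suc b ^ a  ≡⟨ *-distribʳ-+ (suc b ^ a) (b ∸ a) (suc a) ⟨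
    (b ∸ a + suc a) * suc b ^ a
      ≡⟨ cong (_* suc b ^ a) (trans (+-suc (b ∸ a) a) (cong suc (m∸n+n≡m a≤b))) ⟩
    suc b * suc b ^ a                        ∎
  where open ≡-Reasoning

∑<-parkingFormula : ∀ a b → a ≤ suc b →
  ∑[ r < suc a ] ((a C r) * parkingFormula r b) ≡ parkingFormula a (suc b)
∑<-parkingFormula a b a≤1+b = +-cancelʳ-≡ D _ _ (begin
    ∑[ r < suc a ] ((a C r) * parkingFormula r b) + D
  ≡⟨ cong (∑[ r < suc a ] ((a C r) * parkingFormula r b) +_) (∑<-binomial-derivative (suc b) a) ⟨
    ∑[ r < suc a ] ((a C r) * parkingFormula r b) + ∑[ r < suc a ] ((a C r) * (r * suc b ^ (r ∸ 1)))
  ≡⟨ ∑<-+ (suc a) (λ r → (a C r) * parkingFormula r b) (λ r → (a C r) * (r * suc b ^ (r ∸ 1))) ⟨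
    ∑[ r < suc a ] ((a C r) * parkingFormula r b + (a C r) * (r * suc b ^ (r ∸ 1)))
  ≡⟨ ∑<-cong (suc a) (λ r r≤a → trans
       (sym (*-distribˡ-+ (a C r) (parkingFormula r b) (r * suc b ^ (r ∸ 1))))
       (cong ((a C r) *_) (parkingFormula-deficit r b (≤-trans (≤-pred r≤a) a≤1+b)))) ⟩
    ∑[ r < suc a ] ((a C r) * suc b ^ r)
  ≡⟨ ∑<-binomial (suc b) a ⟩
    suc (suc b) ^ a
  ≡⟨ parkingFormula-deficit a (suc b) (m≤n⇒m≤1+n a≤1+b) ⟨
    parkingFormula a (suc b) + D
  ∎)
  where
  open ≡-Reasoning
  D = a * suc (suc b) ^ (a ∸ 1)

parkingCount : ℕ → ℕ → ℕ
parkingCount a b = ∑words (oneTo b) a (𝟙 ∘ Parking? b)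

parkingCount-zero : ∀ b → parkingCount 0 b ≡ 1
parkingCount-zero b = 𝟙-yes (Parking? b []) (λ k k≤b → k≤b)

parkingCount-tooMany : ∀ a b → b < a → parkingCount a b ≡ 0
parkingCount-tooMany a b b<a = ∑words-zero-local (oneTo b) a (oneTo-InRange b) λ {L} inRange |L|≡a →
  𝟙-no (Parking? b L) λ parks →
    <⇒≱ b<a (subst (_≤ b) |L|≡a (Parking⇒length≤ (All.map proj₁ inRange) parks))

parkingCount-shift : ∀ c a b →
  ∑words (map (c +_) (oneTo b)) a (𝟙 ∘ ParkingAbove? c b) ≡ parkingCount a b
parkingCount-shift c a b = trans (∑words-map (oneTo b) a (c +_) _)
  (∑words-cong (oneTo b) a λ L →
    𝟙-cong (ParkingAbove? c b (map (c +_) L)) (Parking? b L) (ParkingAbove-shift c b L))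

parkingCount-extraLetter : ∀ r b → ∑words (oneTo (suc b)) r (𝟙 ∘ Parking? b) ≡ parkingCount r b
parkingCount-extraLetter r b = trans
  (cong (λ vs → ∑words vs r (𝟙 ∘ Parking? b)) (trans (cong oneTo (+-comm 1 b)) (interval-++ 1 b 1)))
  (∑words-++-unused {_≤ b} (oneTo b) (suc b ∷ []) r (𝟙 ∘ Parking? b) (1+n≰n ∷ [])
    (λ {L} L≰b → 𝟙-no (Parking? b L) (L≰b ∘ Parking⇒≤ {b} {L})))

Parking-suc⇔ : ∀ a b L → a ≤ suc b → All (1 ≤_) L → length L ≡ a →
  Parking (suc b) L ⇔ ParkingAbove 1 b (filter (1 <?_) L)
Parking-suc⇔ a b L a≤1+b 1≤L |L|≡a = mk⇔
  (λ parks k k≤b →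
    ≤-pred (subst (_≤ suc b) (trans (sym (past-k k)) (+-suc _ k)) (parks (suc k) (s≤s k≤b))))
  parks-suc
  where
  past-k : ∀ k → #above (suc k) (filter (1 <?_) L) + suc k ≡ #above (suc k) L + suc k
  past-k k = cong (_+ suc k) (sym (#above-ignores-below 1 (suc k) L (s≤s z≤n)))
  parks-suc : ParkingAbove 1 b (filter (1 <?_) L) → Parking (suc b) L
  parks-suc parks zero    _         =
    subst (_≤ suc b) (sym (trans (+-identityʳ _) (trans (#above-all 1≤L) |L|≡a))) a≤1+b
  parks-suc parks (suc k) (s≤s k≤b) =
    subst (_≤ suc b) (trans (sym (+-suc _ k)) (past-k k)) (s≤s (parks k k≤b))

parkingCount-suc : ∀ a b → a ≤ suc b → parkingCount a (suc b) ≡ ∑[ r < suc a ] ((a C r) * parkingCount r b)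
parkingCount-suc a b a≤1+b = begin
    ∑words (oneTo (1 + b)) a (𝟙 ∘ Parking? (suc b))
  ≡⟨ ∑words-cong-local (oneTo (1 + b)) a (oneTo-InRange (suc b)) (λ {L} inRange |L|≡a → trans
       (𝟙-cong (Parking? (suc b) L) (ParkingAbove? 1 b (filter (1 <?_) L))
               (Parking-suc⇔ a b L a≤1+b (All.map proj₁ inRange) |L|≡a))
       (sym (*-identityʳ _))) ⟩
    ∑words (oneTo (1 + b)) a (λ L → 𝟙 (ParkingAbove? 1 b (filter (1 <?_) L)) * 1)
  ≡⟨ ∑words-oneTo-split 1 b a (𝟙 ∘ ParkingAbove? 1 b) (λ _ → 1) ⟩
    ∑[ r < suc a ] ((a C r) * (∑words (map (1 +_) (oneTo b)) r (𝟙 ∘ ParkingAbove? 1 b)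
                                * ∑words (oneTo 1) (a ∸ r) (λ _ → 1)))
  ≡⟨ ∑<-cong (suc a) (λ r _ → cong₂ (λ u v → (a C r) * (u * v))
                                     (parkingCount-shift 1 r b) (∑words-singleton 1 (a ∸ r))) ⟩
    ∑[ r < suc a ] ((a C r) * (parkingCount r b * 1))
  ≡⟨ ∑<-cong (suc a) (λ r _ → cong ((a C r) *_) (*-identityʳ (parkingCount r b))) ⟩
    ∑[ r < suc a ] ((a C r) * parkingCount r b)
  ∎
  where open ≡-Reasoning

parkingCount≡parkingFormula : ∀ a b → parkingCount a b ≡ parkingFormula a b
parkingCount≡parkingFormula zero    b       = parkingCount-zero b
parkingCount≡parkingFormula (suc a) zero    =
  trans (parkingCount-tooMany (suc a) 0 (s≤s z≤n)) (sym (parkingFormula-tooMany (suc a) 0 (s≤s z≤n)))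
parkingCount≡parkingFormula a       (suc b) with a ≤? suc b
... | yes a≤1+b = trans (parkingCount-suc a b a≤1+b)
  (trans (∑<-cong (suc a) (λ r _ → cong ((a C r) *_) (parkingCount≡parkingFormula r b)))
         (∑<-parkingFormula a b a≤1+b))
... | no a≰1+b  =
  trans (parkingCount-tooMany a (suc b) (≰⇒> a≰1+b)) (sym (parkingFormula-tooMany a (suc b) (≰⇒> a≰1+b)))

-- First tight points

Tight : ℕ → List ℕ → ℕ → Set
Tight n L k = #above k L + k ≡ n

Tight? : ∀ n L → Decidable (Tight n L)
Tight? n L k = #above k L + k ≟ n

FirstTight? : ∀ n L i → Dec (NoneBelow (Tight n L) i × Tight n L i)
FirstTight? n L i = NoneBelow? (Tight? n L) i ×-dec Tight? n L i

firstTightCount : ℕ → ℕ → ℕ → ℕ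
firstTightCount n m i = ∑words (oneTo n) m (λ L → 𝟙 (Parking? n L ×-dec FirstTight? n L i))

Parking⇒Tight-end : ∀ {n L} → Parking n L → Tight n L n
Parking⇒Tight-end {n} {L} parks = cong (_+ n) (#above-none (Parking⇒≤ {n} {L} parks))

Parking-∷⇔ : ∀ n j L → j ≤ n → Parking n (j ∷ L) ⇔ (Parking n L × NoneBelow (Tight n L) j)
Parking-∷⇔ n j L j≤n = mk⇔ (λ parks → Parking-∷⁻ {x = j} {L} parks , λ {k} → none-tight parks {k}) cons-parks
  where
  none-tight : Parking n (j ∷ L) → NoneBelow (Tight n L) j
  none-tight parks {k} k<j tight = <-irrefl tight
    (subst (λ a → a + k ≤ n) (#above-∷-> L k<j) (parks k (≤-trans (<⇒≤ k<j) j≤n)))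
  cons-parks : Parking n L × NoneBelow (Tight n L) j → Parking n (j ∷ L)
  cons-parks (parks , none) k k≤n = by-cases (k <? j)
    where
    by-cases : Dec (k < j) → #above k (j ∷ L) + k ≤ n
    by-cases (yes k<j) = subst (λ a → a + k ≤ n) (sym (#above-∷-> L k<j)) (≤∧≢⇒< (parks k k≤n) (none k<j))
    by-cases (no k≮j)  = subst (λ a → a + k ≤ n) (sym (#above-∷-≤ L (≮⇒≥ k≮j))) (parks k k≤n)

PFFirst-uncons : ∀ m n j → PFFirst (suc m) n j ↔ Σ (Vec ℕ m) (λ v → T (isPF (suc m) n (j ∷ toList v)))
PFFirst-uncons m n j = mk↔ₛ′ (λ { (x ∷ᵥ v , pf , refl) → v , pf }) (λ (v , pf) → j ∷ᵥ v , pf , refl)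
                            (λ _ → refl) (λ { (x ∷ᵥ v , pf , refl) → refl })

PFFirst↔Fin-∑firstTight : ∀ m n j → suc m ≤ n → InRange n j →
  PFFirst (suc m) n j ↔ Fin (sumFromTo j n (firstTightCount n m))
PFFirst↔Fin-∑firstTight m n j m<n j∈range =
  ↔-trans (PFFirst-uncons m n j) (↔-trans
    (Σ-Vec↔Fin-∑words n m (λ L → T (isPF (suc m) n (j ∷ L))) (λ L → T? _) (λ L → T-irrelevant)
      (λ {L} pf → All.tail (isPF⇒InRange (suc m) n (j ∷ L) pf)))
    (Fin-cong (begin
      ∑words (oneTo n) m (λ L → 𝟙 (T? (isPF (suc m) n (j ∷ L))))
    ≡⟨ ∑words-cong-local (oneTo n) m (oneTo-InRange n) (λ {L} L∈range |L|≡m →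
         𝟙-cong (T? _) (Parking? n L ×-dec NoneBelow? (Tight? n L) j)
           (⇔.trans (isPF⇔ (suc m) n (j ∷ L) (cong suc |L|≡m) m<n)
           (⇔.trans (mk⇔ proj₂ ((j∈range ∷ L∈range) ,_)) (Parking-∷⇔ n j L (proj₂ j∈range))))) ⟩
      ∑words (oneTo n) m (λ L → 𝟙 (Parking? n L ×-dec NoneBelow? (Tight? n L) j))
    ≡⟨ ∑words-cong (oneTo n) m (λ L →
         𝟙-×-NoneBelow≡∑first (Parking? n L) (Tight? n L) j n (proj₂ j∈range)
                              (Parking⇒Tight-end {n} {L})) ⟩
      ∑words (oneTo n) m (λ L → sumFromTo j n (λ i → 𝟙 (Parking? n L ×-dec FirstTight? n L i)))
    ≡⟨ ∑words-∑∈ (oneTo n) m (applyUpTo id (suc n ∸ j))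
                 (λ d L → 𝟙 (Parking? n L ×-dec FirstTight? n L (j + d))) ⟩
      sumFromTo j n (firstTightCount n m)
    ∎)))
  where open ≡-Reasoning

-- With i = i′ + 1 and n = i + e: a parking word L on n spots has i as first tight point iff
-- its e entries above i park on the spots i + 1, …, n and its other entries park on i′ spots.
module FirstTightAt (i′ e : ℕ) (L : List ℕ) where
  private
    i n : ℕ
    i = suc i′
    n = i + e
  U D : List ℕ
  U = filter (i <?_) L
  D = filter (∁? (i <?_)) L

  private
    below : ∀ {k} → k ≤ i → length U ≡ e → (#above k L + k < n) ⇔ (#above k D + k ≤ i′)
    below {k} k≤i |U|≡e rewrite #above-below-threshold i k L k≤i | |U|≡e = mk⇔
      (λ lt → +-cancelʳ-≤ e _ i′ (subst (_≤ i′ + e) (swap (#above k D) e k) (≤-pred lt)))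
      (λ le → s≤s (subst (_≤ i′ + e) (sym (swap (#above k D) e k)) (+-monoˡ-≤ e le)))
      where
      swap : ∀ x e k → x + e + k ≡ x + k + e
      swap = solve-∀

    above : ∀ k′ → (#above (i + k′) L + (i + k′) ≤ n) ⇔ (#above (i + k′) U + k′ ≤ e)
    above k′ = mk⇔ (+-cancelˡ-≤ i _ e ∘ subst (_≤ n) regroup) (subst (_≤ n) (sym regroup) ∘ +-monoʳ-≤ i)
      where
      shuffle : ∀ x i k′ → x + (i + k′) ≡ i + (x + k′)
      shuffle = solve-∀
      regroup : #above (i + k′) L + (i + k′) ≡ i + (#above (i + k′) U + k′)
      regroup = trans (cong (_+ (i + k′)) (#above-ignores-below i (i + k′) L (m≤m+n i k′))) (shuffle _ i k′)

    tight⇔ : Tight n L i ⇔ (length U ≡ e)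
    tight⇔ rewrite #above-ignores-below i i L ≤-refl | #above-all (all-filter (i <?_) L) =
      mk⇔ (λ eq → +-cancelˡ-≡ i _ e (trans (+-comm i _) eq)) (λ eq → trans (cong (_+ i) eq) (+-comm e i))

  split⇔ : (Parking n L × (NoneBelow (Tight n L) i × Tight n L i)) ⇔
           ((length U ≡ e × ParkingAbove i e U) × Parking i′ D)
  split⇔ = mk⇔ to from
    where
    to : Parking n L × (NoneBelow (Tight n L) i × Tight n L i) →
         (length U ≡ e × ParkingAbove i e U) × Parking i′ D
    to (parks , none , tight) = (|U|≡e , upper) , lower
      where
      |U|≡e = Equivalence.to tight⇔ tight
      upper : ParkingAbove i e U
      upper k′ k′≤e = Equivalence.to (above k′) (parks (i + k′) (+-monoʳ-≤ i k′≤e))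
      lower : Parking i′ D
      lower k k≤i′ = Equivalence.to (below (m≤n⇒m≤1+n k≤i′) |U|≡e)
        (≤∧≢⇒< (parks k (≤-trans k≤i′ (m≤n⇒m≤1+n (m≤m+n i′ e)))) (none (s≤s k≤i′)))
    from : (length U ≡ e × ParkingAbove i e U) × Parking i′ D →
           Parking n L × (NoneBelow (Tight n L) i × Tight n L i)
    from ((|U|≡e , upper) , lower) = parks , (λ k<i → <⇒≢ (strict k<i)) , Equivalence.from tight⇔ |U|≡e
      where
      strict : ∀ {k} → k < i → #above k L + k < n
      strict k<i = Equivalence.from (below (<⇒≤ k<i) |U|≡e) (lower _ (≤-pred k<i))
      parks : Parking n L
      parks k k≤n with k <? i
      ... | yes k<i = <⇒≤ (strict k<i)
      ... | no k≮i with m≤n⇒∃[o]m+o≡n (≮⇒≥ k≮i)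
      ...   | k′ , refl = Equivalence.from (above k′) (upper k′ (+-cancelˡ-≤ i k′ e k≤n))

firstTightCount≡C*parkingCounts : ∀ i′ e r →
  firstTightCount (suc i′ + e) (e + r) (suc i′) ≡ ((e + r) C e) * (parkingCount e e * parkingCount r i′)
firstTightCount≡C*parkingCounts i′ e r = begin
    ∑words (oneTo (i + e)) m (λ L → 𝟙 (Parking? n L ×-dec FirstTight? n L i))
  ≡⟨ ∑words-cong (oneTo (i + e)) m (λ L → trans (𝟙-cong _ _ (FirstTightAt.split⇔ i′ e L))
       (𝟙-× (upperOK? (filter (i <?_) L)) (Parking? i′ (filter (∁? (i <?_)) L)))) ⟩
    ∑words (oneTo (i + e)) m (λ L → 𝟙 (upperOK? (filter (i <?_) L))
                                  * 𝟙 (Parking? i′ (filter (∁? (i <?_)) L)))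
  ≡⟨ ∑words-oneTo-split i e m (𝟙 ∘ upperOK?) (𝟙 ∘ Parking? i′) ⟩
    ∑[ s < suc m ] ((m C s) * (upper s * ∑words (oneTo i) (m ∸ s) (𝟙 ∘ Parking? i′)))
  ≡⟨ ∑<-single (suc m) (λ s → (m C s) * (upper s * lower (m ∸ s))) e (s≤s (m≤m+n e r))
       (λ s _ s≢e → trans (cong (λ u → (m C s) * (u * lower (m ∸ s))) (upper-wrongLength s≢e))
                          (*-zeroʳ (m C s))) ⟩
    (m C e) * (upper e * ∑words (oneTo i) (m ∸ e) (𝟙 ∘ Parking? i′))
  ≡⟨ cong (λ u → (m C e) * (upper e * ∑words (oneTo i) u (𝟙 ∘ Parking? i′))) (m+n∸m≡n e r) ⟩
    (m C e) * (upper e * ∑words (oneTo i) r (𝟙 ∘ Parking? i′))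
  ≡⟨ cong₂ (λ u v → (m C e) * (u * v)) upper-rightLength (parkingCount-extraLetter r i′) ⟩
    (m C e) * (parkingCount e e * parkingCount r i′)
  ∎
  where
  open ≡-Reasoning
  i n m : ℕ
  i = suc i′
  n = i + e
  m = e + r
  upperOK? : ∀ U → Dec (length U ≡ e × ParkingAbove i e U)
  upperOK? U = (length U ≟ e) ×-dec ParkingAbove? i e U
  upper lower : ℕ → ℕ
  upper s = ∑words (map (i +_) (oneTo e)) s (𝟙 ∘ upperOK?)
  lower s = ∑words (oneTo i) s (𝟙 ∘ Parking? i′)
  upper-wrongLength : ∀ {s} → s ≢ e → upper s ≡ 0
  upper-wrongLength {s} s≢e = ∑words-zero-local {λ _ → ⊤} _ s (All.universal _ _) λ {U} _ |U|≡s →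
    𝟙-no (upperOK? U) (λ (|U|≡e , _) → s≢e (trans (sym |U|≡s) |U|≡e))
  upper-rightLength : upper e ≡ parkingCount e e
  upper-rightLength = trans
    (∑words-cong-local {λ _ → ⊤} _ e (All.universal _ _) λ {U} _ |U|≡e →
       𝟙-yes-× (length U ≟ e) (ParkingAbove? i e U) |U|≡e)
    (parkingCount-shift i e e)

firstTightCount-tooFew : ∀ n m i → i + m < n → firstTightCount n m i ≡ 0
firstTightCount-tooFew n m i i+m<n =
  ∑words-zero-local {λ _ → ⊤} (oneTo n) m (All.universal _ _) λ {L} _ |L|≡m →
  𝟙-no (Parking? n L ×-dec FirstTight? n L i) λ (_ , _ , tight) → <⇒≱ i+m<n (begin
    n                   ≡⟨ tight ⟨
    #above i L + i      ≤⟨ +-monoˡ-≤ i (subst (#above i L ≤_) |L|≡m (#above≤length i L)) ⟩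
    m + i               ≡⟨ +-comm m i ⟩
    i + m               ∎)
  where open ≤-Reasoning

firstTightCount-at : ∀ i′ m → firstTightCount (suc i′ + m) m (suc i′) ≡ suc m ^ (m ∸ 1)
firstTightCount-at i′ m = begin
    firstTightCount (suc i′ + m) m (suc i′)
  ≡⟨ cong (λ k → firstTightCount (suc i′ + m) k (suc i′)) (+-identityʳ m) ⟨
    firstTightCount (suc i′ + m) (m + 0) (suc i′)
  ≡⟨ firstTightCount≡C*parkingCounts i′ m 0 ⟩
    ((m + 0) C m) * (parkingCount m m * parkingCount 0 i′)
  ≡⟨ cong₂ (λ c p → c * (p * parkingCount 0 i′))
             (trans (cong (_C m) (+-identityʳ m)) (nCn≡1 m))
             (trans (parkingCount≡parkingFormula m m) (parkingFormula-diag m)) ⟩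
    1 * (suc m ^ (m ∸ 1) * parkingCount 0 i′)
  ≡⟨ trans (*-identityˡ _) (trans (cong (suc m ^ (m ∸ 1) *_) (parkingCount-zero i′)) (*-identityʳ _)) ⟩
    suc m ^ (m ∸ 1)
  ∎
  where open ≡-Reasoning

term≡C*parkingFormulas : ∀ i′ e r₁ → suc r₁ ≤ i′ →
  term (suc (e + suc r₁)) (suc i′ + e) (suc i′) ≡
    ((e + suc r₁) C e) * (parkingFormula e e * parkingFormula (suc r₁) i′)
term≡C*parkingFormulas i′ e r₁ r<i′ = begin
    term (suc m) n i
  ≡⟨ cong₂ _*_ (cong₂ _*_ (cong₂ _*_ (cong (m C_) n∸i≡e) spare≡) (cong (i ^_) exponent≡))
               (cong (λ x → suc x ^ (x ∸ 1)) n∸i≡e) ⟩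
    (m C e) * (i′ ∸ r₁) * i ^ r₁ * suc e ^ (e ∸ 1)
  ≡⟨ regroup (m C e) (i′ ∸ r₁) (i ^ r₁) (suc e ^ (e ∸ 1)) ⟩
    (m C e) * (suc e ^ (e ∸ 1) * parkingFormula (suc r₁) i′)
  ≡⟨ cong (λ p → (m C e) * (p * parkingFormula (suc r₁) i′)) (parkingFormula-diag e) ⟨
    (m C e) * (parkingFormula e e * parkingFormula (suc r₁) i′)
  ∎
  where
  open ≡-Reasoning
  i n m : ℕ
  i = suc i′
  n = i + e
  m = e + suc r₁
  n∸i≡e : n ∸ i ≡ e
  n∸i≡e = m+n∸m≡n i e
  spare≡ : suc (n ∸ suc m) ≡ i′ ∸ r₁
  spare≡ = trans (cong (λ x → suc (x ∸ m)) (+-comm i′ e))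
                 (trans (cong suc ([m+n]∸[m+o]≡n∸o e i′ (suc r₁))) (sym (+-∸-assoc 1 r<i′)))
  exponent≡ : (i + suc m) ∸ (n + 2) ≡ r₁
  exponent≡ = trans (cong (_∸ (n + 2)) (rearrange i′ e r₁)) (m+n∸n≡m r₁ (n + 2))
    where
    rearrange : ∀ i′ e r₁ → suc i′ + suc (e + suc r₁) ≡ r₁ + (suc i′ + e + 2)
    rearrange = solve-∀
  regroup : ∀ c a b p → c * a * b * p ≡ c * (p * (a * b))
  regroup = solve-∀

beyondThreshold⇒e<m : ∀ i e m → suc m ≤ i + e → (i + e) ∸ suc m + 1 < i → e < m
beyondThreshold⇒e<m i e m m<n past = +-cancelˡ-< i e m (begin-strict
    i + e                      ≡⟨ m∸n+n≡m m<n ⟨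
    (i + e) ∸ suc m + suc m    ≡⟨ +-suc _ m ⟩
    suc ((i + e) ∸ suc m + m)  <⟨ +-monoˡ-< m (subst (_< i) (+-comm _ 1) past) ⟩
    i + m                      ∎)
  where open ≤-Reasoning

firstTightCount≡term : ∀ n m i → suc m ≤ n → n ∸ suc m + 1 < i → i ≤ n →
  firstTightCount n m i ≡ term (suc m) n i
firstTightCount≡term n m (suc i′) m<n past i≤n with m≤n⇒∃[o]m+o≡n i≤n
... | e , refl with m≤n⇒∃[o]m+o≡n (<⇒≤ (beyondThreshold⇒e<m (suc i′) e m m<n past))
...   | zero   , refl = contradiction (beyondThreshold⇒e<m (suc i′) e m m<n past) (<-irrefl (sym (+-identityʳ e)))
...   | suc r₁ , refl = begin
    firstTightCount (suc i′ + e) (e + suc r₁) (suc i′)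
  ≡⟨ firstTightCount≡C*parkingCounts i′ e (suc r₁) ⟩
    ((e + suc r₁) C e) * (parkingCount e e * parkingCount (suc r₁) i′)
  ≡⟨ cong₂ (λ p q → ((e + suc r₁) C e) * (p * q))
             (parkingCount≡parkingFormula e e) (parkingCount≡parkingFormula (suc r₁) i′) ⟩
    ((e + suc r₁) C e) * (parkingFormula e e * parkingFormula (suc r₁) i′)
  ≡⟨ term≡C*parkingFormulas i′ e r₁
       (+-cancelˡ-≤ e (suc r₁) i′ (≤-pred (subst (suc (e + suc r₁) ≤_) (cong suc (+-comm i′ e)) m<n))) ⟨
    term (suc (e + suc r₁)) (suc i′ + e) (suc i′)
  ∎
  where open ≡-Reasoning

∑firstTight-beyondThreshold : ∀ n m j → suc m ≤ n → n ∸ suc m + 1 < j →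
  sumFromTo j n (firstTightCount n m) ≡ sumFromTo j n (term (suc m) n)
∑firstTight-beyondThreshold n m j m<n past = sumFromTo-cong j n λ i j≤i i≤n →
  firstTightCount≡term n m i m<n (<-≤-trans past j≤i) i≤n

∑firstTight-uptoThreshold : ∀ n m j → suc m ≤ n → j ≤ n ∸ suc m + 1 →
  sumFromTo j n (firstTightCount n m) ≡ suc m ^ (m ∸ 1) + sumFromTo (n ∸ suc m + 2) n (term (suc m) n)
∑firstTight-uptoThreshold n m j m<n j≤s = begin
    sumFromTo j n E
  ≡⟨ sumFromTo-dropZeros j (t + 1) n E j≤s (m≤n⇒m≤1+n s≤n) (λ i _ i<s →
       firstTightCount-tooFew n m i (≤-<-trans (+-monoˡ-≤ m (≤-pred (subst (i <_) (+-comm t 1) i<s))) t+m<n)) ⟩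
    sumFromTo (t + 1) n E
  ≡⟨ sumFromTo-unfold (t + 1) n E s≤n ⟩
    E (t + 1) + sumFromTo (suc (t + 1)) n E
  ≡⟨ cong₂ _+_ at-threshold (cong (λ a → sumFromTo a n E) (+-suc t 1)) ⟨
    suc m ^ (m ∸ 1) + sumFromTo (t + 2) n E
  ≡⟨ cong (suc m ^ (m ∸ 1) +_) (sumFromTo-cong (t + 2) n λ i t+2≤i i≤n →
       firstTightCount≡term n m i m<n (subst (_≤ i) (+-suc t 1) t+2≤i) i≤n) ⟩
    suc m ^ (m ∸ 1) + sumFromTo (t + 2) n (term (suc m) n)
  ∎
  where
  open ≡-Reasoning
  E : ℕ → ℕ
  E = firstTightCount n m
  t = n ∸ suc m
  t+1+m≡n : suc t + m ≡ n
  t+1+m≡n = trans (sym (+-suc t m)) (m∸n+n≡m m<n)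
  t+m<n : t + m < n
  t+m<n = ≤-reflexive t+1+m≡n
  s≤n : t + 1 ≤ n
  s≤n = subst (_≤ n) (+-comm 1 t) (≤-trans (m≤m+n (suc t) m) (≤-reflexive t+1+m≡n))
  at-threshold : suc m ^ (m ∸ 1) ≡ E (t + 1)
  at-threshold = sym (trans (cong₂ (λ n i → firstTightCount n m i) (sym t+1+m≡n) (+-comm t 1))
                            (firstTightCount-at t m))

corollary4p8 : (m n j : ℕ) → 1 ≤ m → m ≤ n → 1 ≤ j → j ≤ n →
    ((n ∸ m + 1 < j) → PFFirst m n j ↔ Fin (sumFromTo j n (term m n)))
    × ((j ≤ n ∸ m + 1) → PFFirst m n j ↔ Fin (m ^ (m ∸ 2) + sumFromTo (n ∸ m + 2) n (term m n)))
corollary4p8 (suc m) n j _ m<n 1≤j j≤n =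
    (λ past → ↔-trans count (Fin-cong (∑firstTight-beyondThreshold n m j m<n past)))
  , (λ upto → ↔-trans count (Fin-cong (∑firstTight-uptoThreshold n m j m<n upto)))
  where
  count : PFFirst (suc m) n j ↔ Fin (sumFromTo j n (firstTightCount n m))
  count = PFFirst↔Fin-∑firstTight m n j m<n (1≤j , j≤n)
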